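{- Let $\mathcal{W}^{<}$ be the set of Dyck paths whose sequence of valley heights, read from left to right, is strictly increasing. Then $\sum_{D\in\mathcal{W}^<}z^{|D|}=\frac{1-z}{1-2z}$, where $|D|$ is the semilength of $D$.
   Context: A Dyck path of semilength $n$ is a lattice path with steps $\mathbf{u}=(1,1)$ and $\mathbf{d}=(1,-1)$ from $(0,0)$ to $(2n,0)$ never going below the $x$-axis. A valley is an occurrence of consecutive steps $\mathbf{du}$; its height is the $y$-coordinate of its lowest vertex. Paths with no valleys (empty sequence) satisfy the condition. -}

module Defs where

open import Data.Bool using (Bool; true; false; T; _∧_)
open import Data.Nat using (ℕ; zero; suc; _∸_; _<_; _^_; _≡ᵇ_)
open import Data.Nat.Properties using (_<?_)
open import Data.List using (List; []; _∷_; length; filter; concatMap; map)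
open import Data.List.Relation.Unary.Linked using (Linked; linked?)
open import Data.Product using (_×_)
open import Relation.Nullary using (Dec)
open import Relation.Nullary.Decidable using (_×-dec_; T?)

-- steps of a lattice path: u = (1,1), d = (1,-1)
data Step : Set where
  u d : Step

words : ℕ → List (List Step)
words zero = [] ∷ []
words (suc k) = concatMap (λ w → (u ∷ w) ∷ (d ∷ w) ∷ []) (words k)

dyckFrom : ℕ → List Step → Bool
dyckFrom h [] = h ≡ᵇ 0
dyckFrom h (u ∷ s) = dyckFrom (suc h) s
dyckFrom zero (d ∷ s) = false
dyckFrom (suc h) (d ∷ s) = dyckFrom h s

IsDyck : List Step → Set
IsDyck w = T (dyckFrom 0 w)

-- heights of valleys (occurrences of consecutive d u), left to right,
-- when the walk starts at height h; the valley height is the height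
-- of the vertex between the d and the u
valleysFrom : ℕ → List Step → List ℕ
valleysFrom h [] = []
valleysFrom h (u ∷ s) = valleysFrom (suc h) s
valleysFrom h (d ∷ []) = []
valleysFrom h (d ∷ u ∷ s) = (h ∸ 1) ∷ valleysFrom (h ∸ 1) (u ∷ s)
valleysFrom h (d ∷ d ∷ s) = valleysFrom (h ∸ 1) (d ∷ s)

valleyHeights : List Step → List ℕ
valleyHeights = valleysFrom 0

InW< : List Step → Set
InW< w = IsDyck w × Linked _<_ (valleyHeights w)

InW<? : (w : List Step) → Dec (InW< w)
InW<? w = T? (dyckFrom 0 w) ×-dec linked? _<?_ (valleyHeights w)

countW< : ℕ → ℕ
countW< n = length (filter InW<? (words (n Data.Nat.+ n)))

-- coefficient of z^n in (1 - z)/(1 - 2z) = 1 + Σ_{n ≥ 1} 2^(n-1) z^n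
gfCoeff : ℕ → ℕ
gfCoeff zero = 1
gfCoeff (suc n) = 2 ^ n

-- Read a word from left to right and remember the current height h and the
-- least height m allowed for the next valley.  Splitting on the next step gives
-- linear recurrences for the number of accepted continuations, which depend on
-- h and m only through the excess e = h - m.  With j ≥ 1 up-steps still to come, there
-- are (e + 1) 2^(j - 1) of them after an up-step and (e + 1) c(j - 1) after a
-- down-step, where c is the coefficient sequence of (1 - z)/(1 - 2z); at the
-- start h = m = 0, and the count is c(j) itself.
module Submission where

open import Defs
open import Relation.Binary.PropositionalEquality using (_≡_)
open import Data.Nat using (ℕ)

open import Data.Bool using (T; true; false)
open import Data.Empty using (⊥-elim)
open import Data.List using (List; []; _∷_; length; filter; concatMap)
open import Data.List.Properties using (filter-≐)
open import Data.List.Relation.Unary.Linked using (Linked; []; [-]; _∷_)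
open import Data.Nat using (zero; suc; _+_; _*_; _^_; _≤_; _<_; z≤n; s≤s)
open import Data.Nat.Properties
  using (_≤?_; +-suc; +-identityʳ; *-identityˡ; ≤-refl; <⇒≤; <⇒≱; m<n⇒m≤1+n; m<n⇒m<1+n; n<1+n; m≤n+m)
open import Data.Nat.Tactic.RingSolver using (solve-∀)
open import Data.Product using (_×_; _,_)
open import Data.Unit using (⊤; tt)
open import Level using (0ℓ)
open import Relation.Binary.PropositionalEquality using (refl; sym; trans; cong; cong₂; module ≡-Reasoning)
open import Relation.Nullary using (Dec; does; yes; no; ¬_)
open import Relation.Nullary.Decidable using (T?; _×-dec_)
open import Relation.Unary using (Pred; Decidable; _≐_)

AscendingFrom : ℕ → List ℕ → Set
AscendingFrom m []       = ⊤
AscendingFrom m (v ∷ vs) = m ≤ v × AscendingFrom (suc v) vs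

ascendingFrom? : ∀ m vs → Dec (AscendingFrom m vs)
ascendingFrom? m []       = yes tt
ascendingFrom? m (v ∷ vs) = m ≤? v ×-dec ascendingFrom? (suc v) vs

linked⇒ascendingFrom : ∀ {v vs} → Linked _<_ (v ∷ vs) → AscendingFrom (suc v) vs
linked⇒ascendingFrom [-]       = tt
linked⇒ascendingFrom (v<w ∷ l) = v<w , linked⇒ascendingFrom l

linked⇒ascendingFrom0 : ∀ {vs} → Linked _<_ vs → AscendingFrom 0 vs
linked⇒ascendingFrom0 {[]}    _ = tt
linked⇒ascendingFrom0 {_ ∷ _} l = z≤n , linked⇒ascendingFrom l

ascendingFrom⇒linked : ∀ {m vs} → AscendingFrom m vs → Linked _<_ vs
ascendingFrom⇒linked {vs = []}         _             = []
ascendingFrom⇒linked {vs = _ ∷ []}     _             = [-]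
ascendingFrom⇒linked {vs = _ ∷ _ ∷ _} (_ , v<w , a) = v<w ∷ ascendingFrom⇒linked (v<w , a)

-- The suffixes that can follow a prefix ending at height h, when every
-- later valley must have height at least m.
Accepts : ℕ → ℕ → Pred (List Step) 0ℓ
Accepts h m w = T (dyckFrom h w) × AscendingFrom m (valleysFrom h w)

accepts? : ∀ h m → Decidable (Accepts h m)
accepts? h m w = T? (dyckFrom h w) ×-dec ascendingFrom? m (valleysFrom h w)

accepts-d? : ∀ h m → Decidable (λ w → Accepts h m (d ∷ w))
accepts-d? h m w = accepts? h m (d ∷ w)

accepts-du? : ∀ h m → Decidable (λ w → Accepts h m (d ∷ u ∷ w))
accepts-du? h m w = accepts? h m (d ∷ u ∷ w)

InW<≐Accepts : InW< ≐ Accepts 0 0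
InW<≐Accepts = (λ (t , l) → t , linked⇒ascendingFrom0 l) , (λ (t , a) → t , ascendingFrom⇒linked a)

dyckFrom⇒≤length : ∀ h w → T (dyckFrom h w) → h ≤ length w
dyckFrom⇒≤length zero    w       _ = z≤n
dyckFrom⇒≤length (suc h) (u ∷ w) t = m<n⇒m≤1+n (dyckFrom⇒≤length (suc (suc h)) w t)
dyckFrom⇒≤length (suc h) (d ∷ w) t = s≤s (dyckFrom⇒≤length h w t)

count : {P : Pred (List Step) 0ℓ} → Decidable P → ℕ → ℕ
count P? k = length (filter P? (words k))

count-≐ : ∀ {P Q : Pred (List Step) 0ℓ} (P? : Decidable P) (Q? : Decidable Q) → P ≐ Q →
          ∀ k → count P? k ≡ count Q? k
count-≐ P? Q? P≐Q k = cong length (filter-≐ P? Q? P≐Q (words k))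

module _ {P : Pred (List Step) 0ℓ} (P? : Decidable P) where

  count-suc : ∀ k → count P? (suc k) ≡ count (λ w → P? (u ∷ w)) k + count (λ w → P? (d ∷ w)) k
  count-suc k = go (words k)
    where
    go : ∀ ws → length (filter P? (concatMap (λ w → (u ∷ w) ∷ (d ∷ w) ∷ []) ws))
              ≡ length (filter (λ w → P? (u ∷ w)) ws) + length (filter (λ w → P? (d ∷ w)) ws)
    go []       = refl
    go (w ∷ ws) with does (P? (u ∷ w))
    ... | true  with does (P? (d ∷ w))
    ...   | true  = cong suc (trans (cong suc (go ws)) (sym (+-suc _ _)))
    ...   | false = cong suc (go ws)
    go (w ∷ ws) | false with does (P? (d ∷ w))
    ...   | true  = trans (cong suc (go ws)) (sym (+-suc _ _))
    ...   | false = go ws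

count-none : ∀ {P : Pred (List Step) 0ℓ} (P? : Decidable P) k → (∀ w → length w ≡ k → ¬ P w) → count P? k ≡ 0
count-none P? zero ¬P with P? []
... | yes p = ⊥-elim (¬P [] refl p)
... | no  _ = refl
count-none P? (suc k) ¬P = trans (count-suc P? k) (cong₂ _+_
  (count-none _ k (λ w |w| → ¬P (u ∷ w) (cong suc |w|)))
  (count-none _ k (λ w |w| → ¬P (d ∷ w) (cong suc |w|))))

¬dyckFrom-short : ∀ {h k} w → length w ≡ k → k < h → ¬ T (dyckFrom h w)
¬dyckFrom-short w refl k<h t = <⇒≱ k<h (dyckFrom⇒≤length _ w t)

descent-fall : ∀ h m → count (accepts-d? (suc h) m) h ≡ 1
descent-fall zero    m = refl
descent-fall (suc h) m = trans (count-suc (accepts-d? (suc (suc h)) m) h) (cong₂ _+_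
  (count-none _ h (λ w |w| (t , _) → ¬dyckFrom-short w |w| (m<n⇒m<1+n (n<1+n h)) t))
  (descent-fall h m))

descent-rise : ∀ h m → count (accepts? h m) h ≡ 1
descent-rise zero    m = refl
descent-rise (suc h) m = trans (count-suc (accepts? (suc h) m) h) (cong₂ _+_
  (count-none (accepts? (suc (suc h)) m) h (λ w |w| (t , _) → ¬dyckFrom-short w |w| (m<n⇒m<1+n (n<1+n h)) t))
  (descent-fall h m))

-- A continuation from height h with j up-steps still to come has length h + 2j.
rise : ℕ → ℕ → ℕ → ℕ
rise j h m = count (accepts? h m) (h + (j + j))

fall : ℕ → ℕ → ℕ → ℕ
fall j h m = count (accepts-d? (suc h) m) (h + (j + j))

descend : ℕ → ℕ → ℕ → ℕ
descend j zero    m = 0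
descend j (suc h) m = fall j h m

rise-zero : ∀ h m → rise 0 h m ≡ 1
rise-zero h m = trans (cong (count (accepts? h m)) (+-identityʳ h)) (descent-rise h m)

+-suc-twice : ∀ h j → h + (suc j + suc j) ≡ suc (suc h + (j + j))
+-suc-twice = solve-∀

count-down : ∀ j h m → count (accepts-d? h m) (suc h + (j + j)) ≡ descend (suc j) h m
count-down j zero    m = count-none (accepts-d? 0 m) (suc (j + j)) (λ { _ _ (() , _) })
count-down j (suc h) m = cong (count (accepts-d? (suc h) m)) (sym (+-suc-twice h j))

rise-suc : ∀ j h m → rise (suc j) h m ≡ rise j (suc h) m + descend (suc j) h m
rise-suc j h m = begin
  count (accepts? h m) (h + (suc j + suc j))            ≡⟨ cong (count (accepts? h m)) (+-suc-twice h j) ⟩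
  count (accepts? h m) (suc (suc h + (j + j)))          ≡⟨ count-suc (accepts? h m) (suc h + (j + j)) ⟩
  rise j (suc h) m + count (accepts-d? h m) (suc h + (j + j))
                                                        ≡⟨ cong (rise j (suc h) m +_) (count-down j h m) ⟩
  rise j (suc h) m + descend (suc j) h m                ∎
  where open ≡-Reasoning

-- The branch d u of a fall creates a valley at height h.
fall-suc : ∀ j h m → fall (suc j) h m
         ≡ count (accepts-du? (suc h) m) (suc h + (j + j)) + descend (suc j) h m
fall-suc j h m = begin
  fall (suc j) h m                             ≡⟨ cong (count (accepts-d? (suc h) m)) (+-suc-twice h j) ⟩
  count (accepts-d? (suc h) m) (suc k)         ≡⟨ count-suc (accepts-d? (suc h) m) k ⟩
  count (accepts-du? (suc h) m) k + count (accepts-d? h m) k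
                                               ≡⟨ cong (count (accepts-du? (suc h) m) k +_) (count-down j h m) ⟩
  count (accepts-du? (suc h) m) k + descend (suc j) h m ∎
  where
  open ≡-Reasoning
  k = suc h + (j + j)

fall-suc-≤ : ∀ {j h m} → m ≤ h → fall (suc j) h m ≡ rise j (suc h) (suc h) + descend (suc j) h m
fall-suc-≤ {j} {h} {m} m≤h = trans (fall-suc j h m) (cong (_+ descend (suc j) h m)
  (count-≐ (accepts-du? (suc h) m) (accepts? (suc h) (suc h))
           ((λ (t , _ , a) → t , a) , (λ (t , a) → t , m≤h , a)) (suc h + (j + j))))

fall-suc-> : ∀ {j h m} → h < m → fall (suc j) h m ≡ descend (suc j) h m
fall-suc-> {j} {h} {m} h<m = trans (fall-suc j h m) (cong (_+ descend (suc j) h m)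
  (count-none (accepts-du? (suc h) m) (suc h + (j + j)) (λ _ _ (_ , m≤h , _) → <⇒≱ h<m m≤h)))

descend-atOrBelowBound : ∀ j h m → h ≤ m → descend (suc j) h m ≡ 0
descend-atOrBelowBound j zero    m _   = refl
descend-atOrBelowBound j (suc h) m h<m = trans (fall-suc-> h<m) (descend-atOrBelowBound j h m (<⇒≤ h<m))

mutual
  rise-atBound : ∀ j h → rise j h h ≡ gfCoeff j
  rise-atBound zero    h = rise-zero h h
  rise-atBound (suc j) h = trans (rise-aboveBound j 0 h) (*-identityˡ (2 ^ j))

  rise-aboveBound : ∀ j e m → rise (suc j) (e + m) m ≡ suc e * 2 ^ j
  rise-aboveBound zero e m =
    trans (rise-suc 0 (e + m) m) (cong₂ _+_ (rise-zero (suc (e + m)) m) (descend-aboveBound 0 e m))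
  rise-aboveBound (suc j) e m =
    trans (rise-suc (suc j) (e + m) m) (trans (cong₂ _+_ (rise-aboveBound j (suc e) m) (descend-aboveBound (suc j) e m))
      (doubling e (2 ^ j)))
    where
    doubling : ∀ e x → (2 + e) * x + e * x ≡ (1 + e) * (2 * x)
    doubling = solve-∀

  descend-aboveBound : ∀ j e m → descend (suc j) (e + m) m ≡ e * gfCoeff j
  descend-aboveBound j zero    m = descend-atOrBelowBound j m m ≤-refl
  descend-aboveBound j (suc e) m = fall-aboveBound j e m

  fall-aboveBound : ∀ j e m → fall (suc j) (e + m) m ≡ suc e * gfCoeff j
  fall-aboveBound j e m =
    trans (fall-suc-≤ (m≤n+m m e)) (cong₂ _+_ (rise-atBound j (suc (e + m))) (descend-aboveBound j e m))

mainTheorem10 : (n : ℕ) → countW< n ≡ gfCoeff n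
mainTheorem10 n = trans (count-≐ InW<? (accepts? 0 0) InW<≐Accepts (n + n)) (rise-atBound n 0)
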